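{- Let $G=(V,E)$ be a graph and $k\ge 0$ an integer. Let $u,v\in V$ be nonadjacent, let $X=N(u)\cap N(v)$, and let $P=uw_1w_2\dots w_\ell v$ be a chordless $uv$-path (two vertices of $P$ are adjacent iff they are consecutive on $P$) such that $|X\setminus N(w_i)|\ge\sqrt{k}$ for every $i\in\{1,\dots,\ell\}$. Define $G_0=(V,E\cup\{uv\})$, $k_0=k-1$, and for $i\in\{1,\dots,\ell\}$ let $F_i=\{w_ix : x\in X,\ w_ix\notin E\}$, $G_i=(V,E\cup F_i)$, $k_i=k-|F_i|$. Then $(G,k)$ is a YES instance of \textsc{Minimum Fill-in} if and only if $(G_i,k_i)$ is a YES instance of \textsc{Minimum Fill-in} for some $i\in\{0,1,\dots,\ell\}$.
   Context: A graph is chordal if every cycle of length at least four has a chord. \textsc{Minimum Fill-in}: given a graph $G=(V,E)$ and an integer $k$, decide whether there is a set $F$ of unordered pairs of distinct vertices with $|F|\le k$ such that $(V,E\cup F)$ is chordal; $(G,k)$ is a YES instance if such $F$ exists. $N(x)$ denotes the open neighborhood of $x$. -}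

module Defs where

open import Data.Bool using (Bool; true; false; _∧_; _∨_; not)
open import Data.Bool.Properties using (∨-comm; ∧-zeroʳ)
open import Data.Nat using (ℕ; zero; suc; _+_; _<_)
open import Data.Fin using (Fin; toℕ; _≟_)
open import Data.Fin.Properties using (toℕ-injective)
open import Data.List using (List; map)
open import Data.Nat.ListAction using (sum)
open import Data.List.Base using (filter)
open import Data.Empty using (⊥-elim)
open import Data.List using (allFin)
open import Data.Nat using (_<?_; _≤_)
open import Data.Integer using (ℤ; +_) renaming (_≤_ to _≤ℤ_)
open import Data.Product using (Σ; ∃; _×_; _,_)
open import Data.Sum using (_⊎_)
open import Function.Definitions using (Injective)
open import Relation.Binary.PropositionalEquality using (_≡_; refl; cong₂) renaming (sym to ≡-sym)
open import Relation.Nullary using (¬_; yes; no)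
open import Relation.Nullary.Decidable using (⌊_⌋)

_==_ : ∀ {n} → Fin n → Fin n → Bool
a == b = ⌊ a ≟ b ⌋

==-sym : ∀ {n} (a b : Fin n) → (a == b) ≡ (b == a)
==-sym a b with a ≟ b | b ≟ a
... | yes _ | yes _ = refl
... | no _  | no _  = refl
... | yes p | no q  = ⊥-elim (q (≡-sym p))
... | no q  | yes p = ⊥-elim (q (≡-sym p))

record Graph (n : ℕ) : Set where
  field
    adj    : Fin n → Fin n → Bool
    sym    : ∀ a b → adj a b ≡ adj b a
    irrefl : ∀ a → adj a a ≡ false
open Graph public

gen : ∀ {n} → (Fin n → Fin n → Bool) → Graph n
gen h = record
  { adj    = λ a b → (h a b ∨ h b a) ∧ not (a == b)
  ; sym    = λ a b → cong₂ (λ x y → x ∧ not y) (∨-comm (h a b) (h b a)) (==-sym a b)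
  ; irrefl = λ a → irr a
  }
  where
  irr : ∀ a → ((h a a ∨ h a a) ∧ not (a == a)) ≡ false
  irr a with a ≟ a
  ... | yes _ = ∧-zeroʳ (h a a ∨ h a a)
  ... | no ¬p = ⊥-elim (¬p refl)

_∪_ : ∀ {n} → Graph n → Graph n → Graph n
G ∪ H = gen (λ a b → adj G a b ∨ adj H a b)

-- the graph whose only edge is uv (no edges if u = v)
single : ∀ {n} → Fin n → Fin n → Graph n
single u v = gen (λ a b → (a == u) ∧ (b == v))

count : ∀ {n} → (Fin n → Bool) → ℕ
count {n} p = sum (map (λ a → if (p a)) (allFin n))
  where
  if : Bool → ℕ
  if true  = 1
  if false = 0

-- number of edges, i.e. unordered pairs {a,b} (a < b) with a ~ b
edgeCount : ∀ {n} → Graph n → ℕ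
edgeCount {n} G = sum (map (λ a → count (λ b → ⌊ toℕ a <? toℕ b ⌋ ∧ adj G a b)) (allFin n))

CycAdj : (m : ℕ) → Fin m → Fin m → Set
CycAdj m i j =
  (suc (toℕ i) ≡ toℕ j) ⊎ (suc (toℕ j) ≡ toℕ i) ⊎
  ((toℕ i ≡ 0 × suc (toℕ j) ≡ m) ⊎ (toℕ j ≡ 0 × suc (toℕ i) ≡ m))

IsCycle : ∀ {n} → Graph n → (m : ℕ) → (Fin m → Fin n) → Set
IsCycle G m c = Injective _≡_ _≡_ c × (∀ i j → CycAdj m i j → adj G (c i) (c j) ≡ true)

HasChord : ∀ {n} → Graph n → (m : ℕ) → (Fin m → Fin n) → Set
HasChord G m c = Σ (Fin m) λ i → Σ (Fin m) λ j →
  ¬ CycAdj m i j × ¬ (i ≡ j) × adj G (c i) (c j) ≡ true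

Chordal : ∀ {n} → Graph n → Set
Chordal {n} G = ∀ (m : ℕ) → 4 ≤ m → (c : Fin m → Fin n) → IsCycle G m c → HasChord G m c

-- Minimum Fill-in:  (G , k) is a YES instance iff there is a set F of
-- unordered pairs of distinct vertices (represented as a graph on V)
-- with |F| ≤ k and (V , E ∪ F) chordal.  k is an integer (may be negative).

YES : ∀ {n} → Graph n → ℤ → Set
YES {n} G k = Σ (Graph n) λ F → (+ edgeCount F) ≤ℤ k × Chordal (G ∪ F)

inX : ∀ {n} → Graph n → Fin n → Fin n → Fin n → Bool
inX G u v x = adj G u x ∧ adj G v x

countXminusN : ∀ {n} → Graph n → Fin n → Fin n → Fin n → ℕ
countXminusN G u v w = count (λ x → inX G u v x ∧ not (adj G w x))

Fset : ∀ {n} → Graph n → Fin n → Fin n → Fin n → Graph n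
Fset G u v w = gen (λ a b → (a == w) ∧ (inX G u v b ∧ not (adj G w b)))

PathAdj : ∀ {m} → Fin m → Fin m → Set
PathAdj i j = (suc (toℕ i) ≡ toℕ j) ⊎ (suc (toℕ j) ≡ toℕ i)

module Submission where

-- "If": every branch only adds edges S (S = {uv} or S = F_i) to G, so a
-- fill-in F of G ∪ S within budget k - |S| gives the fill-in S ∪ F of G,
-- of size at most |S| + |F| ≤ k  (add-fill).
-- "Only if": let F be a fill-in of G within budget k and H = G ∪ F.  If uv
-- is an edge of H, then uv ∈ F and F ∖ {uv} is a fill-in of G_0 within
-- budget k - 1  (remove-fill).  Otherwise some internal vertex w_i of the
-- path is adjacent in H to every x ∈ X  (complete-internal-vertex), so
-- F_i ⊆ F and F ∖ F_i is a fill-in of G_i within budget k - |F_i|.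
-- The graph-theoretic core is the apex lemma: in a chordal graph, a vertex
-- seeing both ends of a path of distinct vertices but none of its interior
-- vertices forces the two ends to be adjacent.  It follows by extracting a
-- greedy induced subpath (induced-subpath), which together with the apex
-- would otherwise be a chordless cycle of length at least four.  The apex
-- lemma is applied to v and the path x u w_1 … w_b, where w_b is the first
-- path vertex adjacent to v in H.

open import Defs
open import Algebra.Properties.CommutativeSemigroup using (interchange)
open import Data.Bool using (Bool; true; false; _∧_; _∨_; not)
open import Data.Bool.Properties using (∨-idem; ∧-identityʳ; ∨-assoc)
open import Data.Empty using (⊥; ⊥-elim)
open import Data.Fin using (Fin; zero; suc; toℕ; inject₁; fromℕ; fromℕ<; _≟_)
open import Data.Fin.Properties using (suc-injective; toℕ-injective; toℕ<n; toℕ-inject₁; toℕ-fromℕ<; toℕ-fromℕ)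
open import Data.Integer as Z using (+_; _-_)
import Data.Integer.Properties as ZP
open import Data.List using ([]; _∷_; map; allFin)
open import Data.List.Membership.Propositional using (_∈_)
open import Data.List.Membership.Propositional.Properties using (∈-allFin)
open import Data.List.Properties using (map-cong; map-tabulate)
open import Data.List.Relation.Unary.Any using (here; there)
open import Data.Nat using (ℕ; zero; suc; _≤_; _<_; _*_; _+_; _∸_; z≤n; s≤s; _<?_)
open import Data.Nat.Induction using (<-wellFounded)
open import Data.Nat.ListAction using (sum)
open import Data.Nat.Properties
  using (≤-refl; ≤-reflexive; ≤-trans; ≤-pred; <⇒≤; <⇒≢; <⇒≱; <-asym; <-cmp; <-≤-trans; ≤∧≢⇒<;
         m≤n⇒m<n∨m≡n; m≤n⇒m≤1+n; m≤m+n; m≤n+m; +-comm; +-identityʳ; +-mono-≤; +-monoˡ-≤;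
         +-monoʳ-≤; ∸-monoʳ-<; +-commutativeSemigroup; module ≤-Reasoning)
open import Data.Product using (Σ; _×_; _,_; proj₁; proj₂)
open import Data.Sum using (_⊎_; inj₁; inj₂)
open import Function using (_∘_)
open import Function.Bundles using (_⇔_; mk⇔; Equivalence)
open import Function.Definitions using (Injective)
open import Induction.WellFounded using (Acc; acc)
open import Relation.Binary using (tri<; tri≈; tri>)
open import Relation.Binary.PropositionalEquality
  using (_≡_; _≢_; refl; cong; cong₂; trans; subst; subst₂) renaming (sym to ≡-sym)
open import Relation.Nullary using (¬_; yes; no)
open import Relation.Nullary.Decidable using (⌊_⌋; isYes≗does; dec-true; dec-false)

true≢false : true ≢ false
true≢false ()

∧-true : ∀ {a b} → a ∧ b ≡ true → a ≡ true × b ≡ true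
∧-true {true} {true} _ = refl , refl

∨-true : ∀ {a b} → a ∨ b ≡ true → a ≡ true ⊎ b ≡ true
∨-true {true} _ = inj₁ refl
∨-true {false} e = inj₂ e

not-true : ∀ {a} → not a ≡ true → a ≡ false
not-true {false} _ = refl

∨-resolve : ∀ {a b} → a ≡ false → a ∨ b ≡ true → b ≡ true
∨-resolve {false} _ e = e

==-refl : ∀ {n} (a : Fin n) → (a == a) ≡ true
==-refl a = trans (isYes≗does (a ≟ a)) (dec-true (a ≟ a) refl)

==-≢ : ∀ {n} {a b : Fin n} → a ≢ b → (a == b) ≡ false
==-≢ {a = a} {b} a≢b = trans (isYes≗does (a ≟ b)) (dec-false (a ≟ b) a≢b)

==-sound : ∀ {n} (a b : Fin n) → (a == b) ≡ true → a ≡ b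
==-sound a b e with a ≟ b
... | yes a≡b = a≡b
==-sound a b () | no _

adj⇒≢ : ∀ {n} (G : Graph n) {a b} → adj G a b ≡ true → a ≢ b
adj⇒≢ G {a} e refl = true≢false (trans (≡-sym e) (irrefl G a))

gen-adj : ∀ {n} (h : Fin n → Fin n → Bool) a b → adj (gen h) a b ≡ true →
  (h a b ≡ true ⊎ h b a ≡ true) × a ≢ b
gen-adj h a b e = ∨-true (proj₁ (∧-true e)) , distinct
  where
  distinct : a ≢ b
  distinct refl = true≢false (trans (≡-sym (proj₂ (∧-true e)))
                                    (cong not (==-refl a)))

single-adj : ∀ {n} (u v a b : Fin n) → adj (single u v) a b ≡ true →
  (a ≡ u × b ≡ v) ⊎ (a ≡ v × b ≡ u)
single-adj u v a b e with proj₁ (gen-adj (λ a b → (a == u) ∧ (b == v)) a b e)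
... | inj₁ ab = inj₁ (==-sound a u (proj₁ (∧-true ab)) , ==-sound b v (proj₂ (∧-true ab)))
... | inj₂ ba = inj₂ (==-sound a v (proj₂ (∧-true ba)) , ==-sound b u (proj₁ (∧-true ba)))

single-edge : ∀ {n} {u v : Fin n} → u ≢ v → adj (single u v) u v ≡ true
single-edge {u = u} {v} u≢v rewrite ==-refl u | ==-refl v | ==-≢ u≢v = refl

_⊆_ : ∀ {n} → Graph n → Graph n → Set
X ⊆ Y = ∀ a b → adj X a b ≡ true → adj Y a b ≡ true

single-⊆ : ∀ {n} (F : Graph n) {u v : Fin n} → adj F u v ≡ true → single u v ⊆ F
single-⊆ F {u} {v} uv a b e with single-adj u v a b e
... | inj₁ (refl , refl) = uv
... | inj₂ (refl , refl) = trans (sym F v u) uv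

∪-adj : ∀ {n} (X Y : Graph n) a b → adj (X ∪ Y) a b ≡ (adj X a b ∨ adj Y a b)
∪-adj X Y a b rewrite sym X b a | sym Y b a | ∨-idem (adj X a b ∨ adj Y a b) with a ≟ b
... | yes refl rewrite irrefl X a | irrefl Y a = refl
... | no _ = ∧-identityʳ _

⊆-∪ : ∀ {n} (G F : Graph n) → G ⊆ (G ∪ F)
⊆-∪ G F a b e = trans (∪-adj G F a b) (cong (_∨ adj F a b) e)

_∖_ : ∀ {n} → Graph n → Graph n → Graph n
X ∖ Y = record
  { adj    = λ a b → adj X a b ∧ not (adj Y a b)
  ; sym    = λ a b → cong₂ (λ p q → p ∧ not q) (sym X a b) (sym Y a b)
  ; irrefl = λ a → cong (_∧ not (adj Y a a)) (irrefl X a)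
  }

chordal-resp : ∀ {n} (X Y : Graph n) → (∀ a b → adj X a b ≡ adj Y a b) →
  Chordal X → Chordal Y
chordal-resp X Y eq chordal m 4≤m c (c-inj , c-edge)
  with chordal m 4≤m c (c-inj , λ i j ij → trans (eq (c i) (c j)) (c-edge i j ij))
... | i , j , no-adj , i≢j , chord = i , j , no-adj , i≢j , trans (≡-sym (eq (c i) (c j))) chord

sum-map-+ : ∀ {A : Set} (f g : A → ℕ) xs →
  sum (map f xs) + sum (map g xs) ≡ sum (map (λ a → f a + g a) xs)
sum-map-+ f g [] = refl
sum-map-+ f g (x ∷ xs) =
  trans (interchange +-commutativeSemigroup (f x) (sum (map f xs)) (g x) (sum (map g xs)))
        (cong (_+_ (f x + g x)) (sum-map-+ f g xs))

sum-map-mono : ∀ {A : Set} {f g : A → ℕ} → (∀ a → f a ≤ g a) → ∀ xs →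
  sum (map f xs) ≤ sum (map g xs)
sum-map-mono f≤g [] = z≤n
sum-map-mono f≤g (x ∷ xs) = +-mono-≤ (f≤g x) (sum-map-mono f≤g xs)

sum-map-∈ : ∀ {A : Set} (f : A → ℕ) {x : A} {xs} → x ∈ xs → f x ≤ sum (map f xs)
sum-map-∈ f (here refl) = m≤m+n _ _
sum-map-∈ f {xs = y ∷ ys} (there x∈ys) = ≤-trans (sum-map-∈ f x∈ys) (m≤n+m _ (f y))

sum-map-zero : ∀ {A : Set} (f : A → ℕ) → (∀ a → f a ≡ 0) → ∀ xs → sum (map f xs) ≡ 0
sum-map-zero f f≡0 [] = refl
sum-map-zero f f≡0 (x ∷ xs) = cong₂ _+_ (f≡0 x) (sum-map-zero f f≡0 xs)

sumFin : ∀ {n} → (Fin n → ℕ) → ℕ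
sumFin {n} f = sum (map f (allFin n))

sumFin-suc : ∀ {n} (f : Fin (suc n) → ℕ) → sumFin f ≡ f zero + sumFin (f ∘ suc)
sumFin-suc {n} f = cong (λ t → f zero + sum t)
  (trans (map-tabulate suc f) (≡-sym (map-tabulate (λ a → a) (f ∘ suc))))

sumFin-≤1 : ∀ {n} (f : Fin n → ℕ) → (∀ a → f a ≤ 1) →
  (∀ a b → 1 ≤ f a → 1 ≤ f b → a ≡ b) → sumFin f ≤ 1
sumFin-≤1 {zero} f _ _ = z≤n
sumFin-≤1 {suc n} f f≤1 unique rewrite sumFin-suc f with f zero in f₀
... | zero = sumFin-≤1 (f ∘ suc) (f≤1 ∘ suc)
               (λ a b fa fb → suc-injective (unique (suc a) (suc b) fa fb))
... | suc k = subst (λ t → suc k + t ≤ 1) (≡-sym rest≡0)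
                (subst (_≤ 1) (≡-sym (+-identityʳ (suc k))) (subst (_≤ 1) f₀ (f≤1 zero)))
  where
  vanish : ∀ a → f (suc a) ≡ 0
  vanish a with f (suc a) in fa
  ... | zero = refl
  ... | suc _ with unique zero (suc a) (subst (1 ≤_) (≡-sym f₀) (s≤s z≤n))
                                      (subst (1 ≤_) (≡-sym fa) (s≤s z≤n))
  ... | ()
  rest≡0 : sumFin (f ∘ suc) ≡ 0
  rest≡0 = sum-map-zero (f ∘ suc) vanish (allFin n)

indicator : Bool → ℕ
indicator b = count {1} (λ _ → b)

indicator-≤1 : ∀ b → indicator b ≤ 1
indicator-≤1 true = ≤-refl
indicator-≤1 false = z≤n

indicator-true : ∀ {b} → 1 ≤ indicator b → b ≡ true
indicator-true {true} _ = refl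

count-sum : ∀ {n} (p : Fin n → Bool) → count p ≡ sumFin (indicator ∘ p)
count-sum {n} p = cong sum (map-cong (λ a → ≡-sym (+-identityʳ _)) (allFin n))

count-+ : ∀ {n} (p q r : Fin n → Bool) → (∀ a → indicator (p a) + indicator (q a) ≡ indicator (r a)) →
  count p + count q ≡ count r
count-+ {n} p q r pointwise rewrite count-sum p | count-sum q | count-sum r =
  trans (sum-map-+ (indicator ∘ p) (indicator ∘ q) (allFin n))
        (cong sum (map-cong pointwise (allFin n)))

count-≤-+ : ∀ {n} (p q r : Fin n → Bool) → (∀ a → indicator (r a) ≤ indicator (p a) + indicator (q a)) →
  count r ≤ count p + count q
count-≤-+ {n} p q r pointwise rewrite count-sum p | count-sum q | count-sum r =
  subst (sumFin (indicator ∘ r) ≤_) (≡-sym (sum-map-+ (indicator ∘ p) (indicator ∘ q) (allFin n)))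
        (sum-map-mono pointwise (allFin n))

count-pos : ∀ {n} (p : Fin n → Bool) a → p a ≡ true → 1 ≤ count p
count-pos {n} p a pa rewrite count-sum p =
  ≤-trans (subst (λ b → 1 ≤ indicator b) (≡-sym pa) ≤-refl) (sum-map-∈ (indicator ∘ p) (∈-allFin a))

count-≤1 : ∀ {n} (p : Fin n → Bool) → (∀ a b → p a ≡ true → p b ≡ true → a ≡ b) → count p ≤ 1
count-≤1 p unique rewrite count-sum p =
  sumFin-≤1 (indicator ∘ p) (indicator-≤1 ∘ p)
            (λ a b pa pb → unique a b (indicator-true pa) (indicator-true pb))

count-witness : ∀ {n} (p : Fin n → Bool) → 1 ≤ count p → Σ (Fin n) λ a → p a ≡ true
count-witness {zero} p ()
count-witness {suc n} p pos rewrite count-sum p | sumFin-suc (indicator ∘ p) with p zero in p₀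
... | true = zero , p₀
... | false with count-witness (p ∘ suc) (subst (1 ≤_) (≡-sym (count-sum (p ∘ suc))) pos)
... | a , pa = suc a , pa

less : ∀ {n} → Fin n → Fin n → Bool
less a b = ⌊ toℕ a <? toℕ b ⌋

less-sound : ∀ {n} (a b : Fin n) → less a b ≡ true → toℕ a < toℕ b
less-sound a b e with toℕ a <? toℕ b
... | yes a<b = a<b
less-sound a b () | no _

less-complete : ∀ {n} (a b : Fin n) → toℕ a < toℕ b → less a b ≡ true
less-complete a b a<b = trans (isYes≗does (toℕ a <? toℕ b)) (dec-true (toℕ a <? toℕ b) a<b)

edgeCount-∖ : ∀ {n} (S F : Graph n) → S ⊆ F → edgeCount (F ∖ S) + edgeCount S ≡ edgeCount F
edgeCount-∖ {n} S F S⊆F =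
  trans (sum-map-+ _ _ (allFin n)) (cong sum (map-cong (λ a → count-+ _ _ _ (split a)) (allFin n)))
  where
  split : ∀ a b → indicator (less a b ∧ (adj F a b ∧ not (adj S a b))) + indicator (less a b ∧ adj S a b)
                ≡ indicator (less a b ∧ adj F a b)
  split a b with less a b | adj F a b | adj S a b | S⊆F a b
  ... | false | _     | _     | _ = refl
  ... | true  | true  | true  | _ = refl
  ... | true  | true  | false | _ = refl
  ... | true  | false | false | _ = refl
  ... | true  | false | true  | s with s refl
  ... | ()

edgeCount-∪ : ∀ {n} (X Y : Graph n) → edgeCount (X ∪ Y) ≤ edgeCount X + edgeCount Y
edgeCount-∪ {n} X Y =
  subst (edgeCount (X ∪ Y) ≤_) (≡-sym (sum-map-+ _ _ (allFin n)))
        (sum-map-mono (λ a → count-≤-+ _ _ _ (bound a)) (allFin n))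
  where
  bound : ∀ a b → indicator (less a b ∧ adj (X ∪ Y) a b)
                ≤ indicator (less a b ∧ adj X a b) + indicator (less a b ∧ adj Y a b)
  bound a b rewrite ∪-adj X Y a b with less a b | adj X a b | adj Y a b
  ... | false | _     | _     = z≤n
  ... | true  | true  | true  = s≤s z≤n
  ... | true  | true  | false = ≤-refl
  ... | true  | false | true  = ≤-refl
  ... | true  | false | false = ≤-refl

edgeCount-pos-< : ∀ {n} (X : Graph n) a b → toℕ a < toℕ b → adj X a b ≡ true → 1 ≤ edgeCount X
edgeCount-pos-< X a b a<b ab =
  ≤-trans (count-pos _ b (cong₂ _∧_ (less-complete a b a<b) ab))
          (sum-map-∈ (λ a → count (λ b → less a b ∧ adj X a b)) (∈-allFin a))

edgeCount-pos : ∀ {n} (X : Graph n) a b → adj X a b ≡ true → 1 ≤ edgeCount X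
edgeCount-pos X a b ab with <-cmp (toℕ a) (toℕ b)
... | tri< a<b _ _ = edgeCount-pos-< X a b a<b ab
... | tri≈ _ a≡b _ = ⊥-elim (adj⇒≢ X ab (toℕ-injective a≡b))
... | tri> _ _ b<a = edgeCount-pos-< X b a b<a (trans (sym X b a) ab)

single-oriented : ∀ {n} (u v : Fin n) {a b a' b'} →
  (less a b ∧ adj (single u v) a b) ≡ true → (less a' b' ∧ adj (single u v) a' b') ≡ true →
  a ≡ a' × b ≡ b'
single-oriented u v {a} {b} {a'} {b'} e e'
  with ∧-true {less a b} e | ∧-true {less a' b'} e'
... | a<b , ab | a'<b' , a'b' with single-adj u v a b ab | single-adj u v a' b' a'b'
... | inj₁ (refl , refl) | inj₁ (refl , refl) = refl , refl
... | inj₂ (refl , refl) | inj₂ (refl , refl) = refl , refl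
... | inj₁ (refl , refl) | inj₂ (refl , refl) =
  ⊥-elim (<-asym (less-sound _ _ a<b) (less-sound _ _ a'<b'))
... | inj₂ (refl , refl) | inj₁ (refl , refl) =
  ⊥-elim (<-asym (less-sound _ _ a<b) (less-sound _ _ a'<b'))

edgeCount-single : ∀ {n} (u v : Fin n) → edgeCount (single u v) ≤ 1
edgeCount-single {n} u v = sumFin-≤1 row
  (λ a → count-≤1 (edge-from a) (λ b b' e e' → proj₂ (single-oriented u v {a} {b} e e')))
  unique-row
  where
  edge-from : Fin n → Fin n → Bool
  edge-from a b = less a b ∧ adj (single u v) a b
  row : Fin n → ℕ
  row a = count (edge-from a)
  unique-row : ∀ a a' → 1 ≤ row a → 1 ≤ row a' → a ≡ a'
  unique-row a a' ra ra' with count-witness (edge-from a) ra | count-witness (edge-from a') ra'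
  ... | b , e | b' , e' = proj₁ (single-oriented u v {a} {b} {a'} {b'} e e')

budget-intro : ∀ a c k → a + c ≤ k → + a Z.≤ + k - + c
budget-intro a c k a+c≤k = subst (Z._≤ + k - + c) cancel (ZP.+-monoˡ-≤ (Z.- + c) (Z.+≤+ a+c≤k))
  where
  cancel : + (a + c) - + c ≡ + a
  cancel rewrite ZP.pos-+ a c | ZP.+-assoc (+ a) (+ c) (Z.- + c) | ZP.+-inverseʳ (+ c) =
    ZP.+-identityʳ (+ a)

budget-elim : ∀ a c k → + a Z.≤ + k - + c → a + c ≤ k
budget-elim a c k a≤k-c =
  ZP.drop‿+≤+ (subst₂ Z._≤_ (≡-sym (ZP.pos-+ a c)) cancel (ZP.+-monoˡ-≤ (+ c) a≤k-c))
  where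
  cancel : + k - + c Z.+ + c ≡ + k
  cancel rewrite ZP.+-assoc (+ k) (Z.- + c) (+ c) | ZP.+-inverseˡ (+ c) = ZP.+-identityʳ (+ k)

add-fill : ∀ {n} (G S : Graph n) (k c : ℕ) → edgeCount S ≤ c →
  YES (G ∪ S) (+ k - + c) → YES G (+ k)
add-fill G S k c |S|≤c (F , |F|≤k-c , chordal) =
  S ∪ F , Z.+≤+ size , chordal-resp ((G ∪ S) ∪ F) (G ∪ (S ∪ F)) reassociate chordal
  where
  size : edgeCount (S ∪ F) ≤ k
  size = begin
    edgeCount (S ∪ F)           ≤⟨ edgeCount-∪ S F ⟩
    edgeCount S + edgeCount F   ≤⟨ +-monoˡ-≤ (edgeCount F) |S|≤c ⟩
    c + edgeCount F             ≡⟨ +-comm c (edgeCount F) ⟩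
    edgeCount F + c             ≤⟨ budget-elim (edgeCount F) c k |F|≤k-c ⟩
    k                           ∎
    where open ≤-Reasoning
  reassociate : ∀ a b → adj ((G ∪ S) ∪ F) a b ≡ adj (G ∪ (S ∪ F)) a b
  reassociate a b
    rewrite ∪-adj (G ∪ S) F a b | ∪-adj G S a b | ∪-adj G (S ∪ F) a b | ∪-adj S F a b =
    ∨-assoc (adj G a b) (adj S a b) (adj F a b)

remove-fill : ∀ {n} (G S F : Graph n) (k c : ℕ) → S ⊆ F → c ≤ edgeCount S →
  + edgeCount F Z.≤ + k → Chordal (G ∪ F) → YES (G ∪ S) (+ k - + c)
remove-fill G S F k c S⊆F c≤|S| |F|≤k chordal =
  F ∖ S , budget-intro (edgeCount (F ∖ S)) c k size ,
  chordal-resp (G ∪ F) ((G ∪ S) ∪ (F ∖ S)) same-edges chordal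
  where
  size : edgeCount (F ∖ S) + c ≤ k
  size = begin
    edgeCount (F ∖ S) + c            ≤⟨ +-monoʳ-≤ (edgeCount (F ∖ S)) c≤|S| ⟩
    edgeCount (F ∖ S) + edgeCount S  ≡⟨ edgeCount-∖ S F S⊆F ⟩
    edgeCount F                      ≤⟨ ZP.drop‿+≤+ |F|≤k ⟩
    k                                ∎
    where open ≤-Reasoning
  same-edges : ∀ a b → adj (G ∪ F) a b ≡ adj ((G ∪ S) ∪ (F ∖ S)) a b
  same-edges a b rewrite ∪-adj (G ∪ S) (F ∖ S) a b | ∪-adj G S a b | ∪-adj G F a b
    with adj G a b | adj S a b | adj F a b | S⊆F a b
  ... | true  | _     | _     | _ = refl
  ... | false | true  | true  | _ = refl
  ... | false | false | true  | _ = refl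
  ... | false | false | false | _ = refl
  ... | false | true  | false | s with s refl
  ... | ()

Fset-adj : ∀ {n} (G : Graph n) (u v w a b : Fin n) → adj (Fset G u v w) a b ≡ true →
  Σ (Fin n) λ x → ((a ≡ w × b ≡ x) ⊎ (a ≡ x × b ≡ w)) ×
                  inX G u v x ≡ true × adj G w x ≡ false × w ≢ x
Fset-adj G u v w a b e with gen-adj (λ a b → (a == w) ∧ (inX G u v b ∧ not (adj G w b))) a b e
... | inj₁ hab , a≢b with ∧-true {a == w} hab
...   | a=w , xb with ==-sound a w a=w | ∧-true {inX G u v b} xb
...     | refl | b∈X , wb∉E = b , inj₁ (refl , refl) , b∈X , not-true wb∉E , a≢b
Fset-adj G u v w a b e | inj₂ hba , a≢b with ∧-true {b == w} hba
...   | b=w , xa with ==-sound b w b=w | ∧-true {inX G u v a} xa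
...     | refl | a∈X , wa∉E = a , inj₂ (refl , refl) , a∈X , not-true wa∉E , a≢b ∘ ≡-sym

Fset-⊆ : ∀ {n} (G F : Graph n) (u v w : Fin n) →
  (∀ x → inX G u v x ≡ true → w ≢ x → adj (G ∪ F) w x ≡ true) → Fset G u v w ⊆ F
Fset-⊆ G F u v w complete a b e with Fset-adj G u v w a b e
... | x , ends , x∈X , wx∉E , w≢x with ∨-resolve wx∉E (trans (≡-sym (∪-adj G F w x)) (complete x x∈X w≢x))
...   | wx∈F with ends
...     | inj₁ (refl , refl) = wx∈F
...     | inj₂ (refl , refl) = trans (sym F x w) wx∈F

firstTrue : (P : ℕ → Bool) (w : ℕ) → P w ≡ true →
  Σ ℕ λ a → a ≤ w × P a ≡ true × (∀ d → d < a → P d ≡ false)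
firstTrue P w Pw with P 0 in P0
... | true = 0 , z≤n , P0 , λ _ ()
firstTrue P zero Pw | false = ⊥-elim (true≢false (trans (≡-sym Pw) P0))
firstTrue P (suc w) Pw | false with firstTrue (P ∘ suc) w Pw
... | a , a≤w , Pa , before = suc a , s≤s a≤w , Pa , earlier
  where
  earlier : ∀ d → d < suc a → P d ≡ false
  earlier zero _ = P0
  earlier (suc d) d<a = before d (≤-pred d<a)

lastTrue : (P : ℕ → Bool) (m w : ℕ) → w ≤ m → P w ≡ true →
  Σ ℕ λ a → w ≤ a × a ≤ m × P a ≡ true × (∀ d → a < d → d ≤ m → P d ≡ false)
lastTrue P m w w≤m Pw with P m in Pm
... | true = m , w≤m , ≤-refl , Pm , λ d m<d d≤m → ⊥-elim (<⇒≱ m<d d≤m)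
lastTrue P zero w z≤n Pw | false = ⊥-elim (true≢false (trans (≡-sym Pw) Pm))
lastTrue P (suc m) w w≤m Pw | false with m≤n⇒m<n∨m≡n w≤m
... | inj₂ refl = ⊥-elim (true≢false (trans (≡-sym Pw) Pm))
... | inj₁ w≤m' with lastTrue P m w (≤-pred w≤m') Pw
...   | a , w≤a , a≤m , Pa , beyond = a , w≤a , m≤n⇒m≤1+n a≤m , Pa , later
  where
  later : ∀ d → a < d → d ≤ suc m → P d ≡ false
  later d a<d d≤m with m≤n⇒m<n∨m≡n d≤m
  ... | inj₁ d<m = beyond d a<d (≤-pred d<m)
  ... | inj₂ refl = Pm

record InducedSubpath {n} (H : Graph n) (q : ℕ → Fin n) (s m : ℕ) : Set where
  field
    len     : ℕ
    pos     : ℕ → ℕ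
    pos-0   : pos 0 ≡ s
    pos-len : pos len ≡ m
    pos-<   : ∀ i j → i < j → j ≤ len → pos i < pos j
    edge    : ∀ i → i < len → adj H (q (pos i)) (q (pos (suc i))) ≡ true
    induced : ∀ i j → suc i < j → j ≤ len → adj H (q (pos i)) (q (pos j)) ≡ false

  pos-≥ : ∀ j → j ≤ len → s ≤ pos j
  pos-≥ zero _ = ≤-reflexive (≡-sym pos-0)
  pos-≥ (suc j) j≤len = subst (_≤ pos (suc j)) pos-0 (<⇒≤ (pos-< 0 (suc j) (s≤s z≤n) j≤len))

  pos-≤ : ∀ j → j ≤ len → pos j ≤ m
  pos-≤ j j≤len with m≤n⇒m<n∨m≡n j≤len
  ... | inj₁ j<len = subst (pos j ≤_) pos-len (<⇒≤ (pos-< j len j<len ≤-refl))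
  ... | inj₂ refl = ≤-reflexive pos-len

trivial-subpath : ∀ {n} (H : Graph n) (q : ℕ → Fin n) (s : ℕ) → InducedSubpath H q s s
trivial-subpath H q s = record
  { len = 0 ; pos = λ _ → s ; pos-0 = refl ; pos-len = refl
  ; pos-< = λ { _ zero () _ ; _ (suc _) _ () }
  ; edge = λ _ ()
  ; induced = λ { _ zero () _ ; _ (suc _) _ () }
  }

prepend : ∀ {n} {H : Graph n} {q : ℕ → Fin n} {s a m : ℕ} → InducedSubpath H q a m →
  s < a → adj H (q s) (q a) ≡ true → (∀ d → a < d → d ≤ m → adj H (q s) (q d) ≡ false) →
  InducedSubpath H q s m
prepend {H = H} {q} {s} {a} {m} P s<a sa beyond = record
  { len = suc len ; pos = pos′ ; pos-0 = refl ; pos-len = pos-len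
  ; pos-< = pos′-< ; edge = edge′ ; induced = induced′ }
  where
  open InducedSubpath P
  pos′ : ℕ → ℕ
  pos′ zero = s
  pos′ (suc i) = pos i
  pos′-< : ∀ i j → i < j → j ≤ suc len → pos′ i < pos′ j
  pos′-< zero (suc j) _ j≤len = <-≤-trans s<a (pos-≥ j (≤-pred j≤len))
  pos′-< (suc i) (suc j) i<j j≤len = pos-< i j (≤-pred i<j) (≤-pred j≤len)
  edge′ : ∀ i → i < suc len → adj H (q (pos′ i)) (q (pos′ (suc i))) ≡ true
  edge′ zero _ = subst (λ t → adj H (q s) (q t) ≡ true) (≡-sym pos-0) sa
  edge′ (suc i) i<len = edge i (≤-pred i<len)
  induced′ : ∀ i j → suc i < j → j ≤ suc len → adj H (q (pos′ i)) (q (pos′ j)) ≡ false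
  induced′ zero (suc j) (s≤s 1≤j) j≤len =
    beyond (pos j) (subst (_< pos j) pos-0 (pos-< 0 j 1≤j (≤-pred j≤len))) (pos-≤ j (≤-pred j≤len))
  induced′ (suc i) (suc j) i<j j≤len = induced i j (≤-pred i<j) (≤-pred j≤len)

-- Every walk q 0, …, q m contains an induced path from q s to q m (s ≤ m),
-- obtained greedily by always jumping to the furthest neighbour.
induced-subpath : ∀ {n} (H : Graph n) (q : ℕ → Fin n) (m : ℕ) →
  (∀ d → d < m → adj H (q d) (q (suc d)) ≡ true) →
  ∀ s → s ≤ m → InducedSubpath H q s m
induced-subpath H q m walk s s≤m = greedy s s≤m (<-wellFounded (m ∸ s))
  where
  greedy : ∀ s → s ≤ m → Acc _<_ (m ∸ s) → InducedSubpath H q s m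
  greedy s s≤m (acc smaller) with m≤n⇒m<n∨m≡n s≤m
  ... | inj₂ refl = trivial-subpath H q s
  ... | inj₁ s<m with lastTrue (λ d → adj H (q s) (q d)) m (suc s) s<m (walk s s<m)
  ...   | a , s<a , a≤m , sa , beyond =
    prepend (greedy a a≤m (smaller (∸-monoʳ-< s<a a≤m))) s<a sa beyond

CycAdj-sym : ∀ {L} {i j : Fin L} → CycAdj L i j → CycAdj L j i
CycAdj-sym (inj₁ e) = inj₂ (inj₁ e)
CycAdj-sym (inj₂ (inj₁ e)) = inj₁ e
CycAdj-sym (inj₂ (inj₂ (inj₁ wrap))) = inj₂ (inj₂ (inj₂ wrap))
CycAdj-sym (inj₂ (inj₂ (inj₂ wrap))) = inj₂ (inj₂ (inj₁ wrap))

sequence-cycle : ∀ {n} (H : Graph n) (L : ℕ) (f : ℕ → Fin n) →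
  (∀ i j → i < j → j < L → f i ≢ f j) →
  (∀ i → suc i < L → adj H (f i) (f (suc i)) ≡ true) →
  (∀ j → suc j ≡ L → adj H (f 0) (f j) ≡ true) →
  IsCycle H L (f ∘ toℕ)
sequence-cycle H L f distinct step close = injective , consecutive
  where
  injective : Injective _≡_ _≡_ (f ∘ toℕ)
  injective {i} {j} e with <-cmp (toℕ i) (toℕ j)
  ... | tri< i<j _ _ = ⊥-elim (distinct _ _ i<j (toℕ<n j) e)
  ... | tri≈ _ i≡j _ = toℕ-injective i≡j
  ... | tri> _ _ j<i = ⊥-elim (distinct _ _ j<i (toℕ<n i) (≡-sym e))
  forward : ∀ (i j : Fin L) → suc (toℕ i) ≡ toℕ j → adj H (f (toℕ i)) (f (toℕ j)) ≡ true
  forward i j e = subst (λ t → adj H (f (toℕ i)) (f t) ≡ true) e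
                        (step (toℕ i) (subst (_< L) (≡-sym e) (toℕ<n j)))
  wrap : ∀ (i j : Fin L) → toℕ i ≡ 0 → suc (toℕ j) ≡ L → adj H (f (toℕ i)) (f (toℕ j)) ≡ true
  wrap i j i≡0 j≡L = subst (λ t → adj H (f t) (f (toℕ j)) ≡ true) (≡-sym i≡0) (close (toℕ j) j≡L)
  consecutive : ∀ i j → CycAdj L i j → adj H (f (toℕ i)) (f (toℕ j)) ≡ true
  consecutive i j (inj₁ e) = forward i j e
  consecutive i j (inj₂ (inj₁ e)) = trans (sym H _ _) (forward j i e)
  consecutive i j (inj₂ (inj₂ (inj₁ (i≡0 , j≡L)))) = wrap i j i≡0 j≡L
  consecutive i j (inj₂ (inj₂ (inj₂ (j≡0 , i≡L)))) = trans (sym H _ _) (wrap j i j≡0 i≡L)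

no-chordless-cycle : ∀ {n} (H : Graph n) → Chordal H → (L : ℕ) → 4 ≤ L → (f : ℕ → Fin n) →
  (∀ i j → i < j → j < L → f i ≢ f j) →
  (∀ i → suc i < L → adj H (f i) (f (suc i)) ≡ true) →
  (∀ j → suc j ≡ L → adj H (f 0) (f j) ≡ true) →
  (∀ i j → suc i < j → j < L → (i ≡ 0 → suc j ≢ L) → adj H (f i) (f j) ≡ false) → ⊥
no-chordless-cycle H chordal L 4≤L f distinct step close chordless =
  no-chord (chordal L 4≤L (f ∘ toℕ) (sequence-cycle H L f distinct step close))
  where
  no-chord-< : ∀ i j → toℕ i < toℕ j → ¬ CycAdj L i j → adj H (f (toℕ i)) (f (toℕ j)) ≡ false
  no-chord-< i j i<j ¬adj = chordless (toℕ i) (toℕ j) (≤∧≢⇒< i<j (¬adj ∘ inj₁)) (toℕ<n j)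
                              (λ i≡0 j≡L → ¬adj (inj₂ (inj₂ (inj₁ (i≡0 , j≡L)))))
  no-chord : HasChord H L (f ∘ toℕ) → ⊥
  no-chord (i , j , ¬adj , i≢j , chord) with <-cmp (toℕ i) (toℕ j)
  ... | tri< i<j _ _ = true≢false (trans (≡-sym chord) (no-chord-< i j i<j ¬adj))
  ... | tri≈ _ i≡j _ = i≢j (toℕ-injective i≡j)
  ... | tri> _ _ j<i =
    true≢false (trans (≡-sym chord) (trans (sym H _ _) (no-chord-< j i j<i (¬adj ∘ CycAdj-sym))))

-- Then q 0 and q m are adjacent: otherwise z followed by
-- an induced subpath from q 0 to q m would be a chordless cycle of length ≥ 4.
apex-lemma : ∀ {n} (H : Graph n) → Chordal H → (q : ℕ → Fin n) (m : ℕ) (z : Fin n) → 1 ≤ m →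
  (∀ i j → i < j → j ≤ m → q i ≢ q j) →
  (∀ d → d < m → adj H (q d) (q (suc d)) ≡ true) →
  (∀ d → d ≤ m → z ≢ q d) →
  adj H z (q 0) ≡ true → adj H z (q m) ≡ true →
  (∀ d → 0 < d → d < m → adj H z (q d) ≡ false) →
  adj H (q 0) (q m) ≡ true
apex-lemma {n} H chordal q m z 1≤m distinct walk z-new z-first z-last z-interior =
  by-length len refl
  where
  open InducedSubpath (induced-subpath H q m walk 0 z≤n)

  cyc : ℕ → Fin n
  cyc zero = z
  cyc (suc i) = q (pos i)

  cyc-distinct : ∀ i j → i < j → j < suc (suc len) → cyc i ≢ cyc j
  cyc-distinct zero (suc j) _ j<L = z-new (pos j) (pos-≤ j (≤-pred (≤-pred j<L)))
  cyc-distinct (suc i) (suc j) i<j j<L =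
    distinct (pos i) (pos j) (pos-< i j (≤-pred i<j) (≤-pred (≤-pred j<L))) (pos-≤ j (≤-pred (≤-pred j<L)))

  cyc-step : ∀ i → suc i < suc (suc len) → adj H (cyc i) (cyc (suc i)) ≡ true
  cyc-step zero _ = subst (λ t → adj H z (q t) ≡ true) (≡-sym pos-0) z-first
  cyc-step (suc i) i<L = edge i (≤-pred (≤-pred i<L))

  cyc-close : ∀ j → suc j ≡ suc (suc len) → adj H z (cyc j) ≡ true
  cyc-close .(suc len) refl = subst (λ t → adj H z (q t) ≡ true) (≡-sym pos-len) z-last

  cyc-chordless : ∀ i j → suc i < j → j < suc (suc len) → (i ≡ 0 → suc j ≢ suc (suc len)) →
    adj H (cyc i) (cyc j) ≡ false
  cyc-chordless zero (suc j) (s≤s 1≤j) j<L not-closing =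
    z-interior (pos j) (subst (_< pos j) pos-0 (pos-< 0 j 1≤j j≤len))
                       (subst (pos j <_) pos-len (pos-< j len j<len ≤-refl))
    where
    j≤len : j ≤ len
    j≤len = ≤-pred (≤-pred j<L)
    j<len : j < len
    j<len = ≤∧≢⇒< j≤len (λ j≡len → not-closing refl (cong (λ t → suc (suc t)) j≡len))
  cyc-chordless (suc i) (suc j) i<j j<L _ = induced i j (≤-pred i<j) (≤-pred (≤-pred j<L))

  by-length : ∀ l → len ≡ l → adj H (q 0) (q m) ≡ true
  by-length zero len≡0 =
    ⊥-elim (<⇒≢ 1≤m (trans (≡-sym pos-0) (trans (cong pos (≡-sym len≡0)) pos-len)))
  by-length (suc zero) len≡1 =
    subst₂ (λ i j → adj H (q i) (q j) ≡ true) pos-0 (trans (cong pos (≡-sym len≡1)) pos-len)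
           (edge 0 (subst (0 <_) (≡-sym len≡1) (s≤s z≤n)))
  by-length (suc (suc t)) len≡ =
    ⊥-elim (no-chordless-cycle H chordal (suc (suc len)) 4≤L cyc
              cyc-distinct cyc-step cyc-close cyc-chordless)
    where
    4≤L : 4 ≤ suc (suc len)
    4≤L = s≤s (s≤s (subst (2 ≤_) (≡-sym len≡) (s≤s (s≤s z≤n))))

-- For the least b with r b adjacent to v in H we have
-- 1 ≤ b ≤ m, and r b is adjacent in H to every common G-neighbour x ≠ r b of
-- u and v: apply the apex lemma to v and the walk x, r 0, …, r b.
complete-vertex : ∀ {n} (G H : Graph n) → Chordal H → G ⊆ H → (r : ℕ → Fin n) (m : ℕ) →
  (∀ d → d < suc m → adj G (r d) (r (suc d)) ≡ true) →
  (∀ d d' → d ≤ suc m → d' ≤ suc m → r d ≡ r d' → d ≡ d') →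
  adj H (r 0) (r (suc m)) ≡ false →
  Σ ℕ λ b → 1 ≤ b × b ≤ m ×
    (∀ x → inX G (r 0) (r (suc m)) x ≡ true → r b ≢ x → adj H (r b) x ≡ true)
complete-vertex {n} G H chordal G⊆H r m walk r-inj u≁v
  with firstTrue (λ d → adj H (r (suc m)) (r d)) m (trans (sym H _ _) (G⊆H _ _ (walk m ≤-refl)))
... | zero , _ , vu , _ = ⊥-elim (true≢false (trans (≡-sym vu) (trans (sym H _ _) u≁v)))
... | suc b′ , b≤m , vw , before = suc b′ , s≤s z≤n , b≤m , complete
  where
  complete : ∀ x → inX G (r 0) (r (suc m)) x ≡ true → r (suc b′) ≢ x → adj H (r (suc b′)) x ≡ true
  complete x x∈X w≢x =
    trans (sym H _ _) (apex-lemma H chordal q (suc (suc b′)) v (s≤s z≤n)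
                         distinct step v-new (G⊆H _ _ vx) vw interior)
    where
    v = r (suc m)
    ux = proj₁ (∧-true {adj G (r 0) x} x∈X)
    vx = proj₂ (∧-true {adj G (r 0) x} x∈X)

    q : ℕ → Fin n
    q zero = x
    q (suc d) = r d

    below-m : ∀ {d} → d ≤ suc b′ → d ≤ suc m
    below-m d≤b = m≤n⇒m≤1+n (≤-trans d≤b b≤m)

    distinct : ∀ i j → i < j → j ≤ suc (suc b′) → q i ≢ q j
    distinct zero (suc d) _ d≤b x≡rd with m≤n⇒m<n∨m≡n (≤-pred d≤b)
    ... | inj₁ d<b = true≢false (trans (≡-sym (subst (λ t → adj H v t ≡ true) x≡rd (G⊆H _ _ vx)))
                                       (before d d<b))
    ... | inj₂ refl = w≢x (≡-sym x≡rd)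
    distinct (suc i) (suc j) i<j j≤b ri≡rj =
      <⇒≢ (≤-pred i<j) (r-inj i j (below-m (≤-trans (<⇒≤ (≤-pred i<j)) (≤-pred j≤b)))
                                  (below-m (≤-pred j≤b)) ri≡rj)

    step : ∀ d → d < suc (suc b′) → adj H (q d) (q (suc d)) ≡ true
    step zero _ = trans (sym H _ _) (G⊆H _ _ ux)
    step (suc d) d<b = G⊆H _ _ (walk d (s≤s (≤-trans (≤-pred (≤-pred d<b)) (<⇒≤ b≤m))))

    v-new : ∀ d → d ≤ suc (suc b′) → v ≢ q d
    v-new zero _ v≡x = adj⇒≢ G vx v≡x
    v-new (suc d) d≤b v≡rd = <⇒≢ (s≤s (≤-trans (≤-pred d≤b) b≤m))
                                 (≡-sym (r-inj (suc m) d ≤-refl (below-m (≤-pred d≤b)) v≡rd))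

    interior : ∀ d → 0 < d → d < suc (suc b′) → adj H v (q d) ≡ false
    interior (suc d) _ d<b = before d (≤-pred d<b)

clamp : (k d : ℕ) → Fin (suc k)
clamp k zero = zero
clamp zero (suc d) = zero
clamp (suc k) (suc d) = suc (clamp k d)

toℕ-clamp : ∀ k d → d ≤ k → toℕ (clamp k d) ≡ d
toℕ-clamp k zero _ = refl
toℕ-clamp (suc k) (suc d) d≤k = cong suc (toℕ-clamp k d (≤-pred d≤k))

clamp-last : ∀ k → clamp k k ≡ fromℕ k
clamp-last k = toℕ-injective (trans (toℕ-clamp k k ≤-refl) (≡-sym (toℕ-fromℕ k)))

clamp-inject : ∀ {k} d (d<k : d < k) → clamp k d ≡ inject₁ (fromℕ< d<k)
clamp-inject d d<k =
  toℕ-injective (trans (toℕ-clamp _ d (<⇒≤ d<k))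
                       (≡-sym (trans (toℕ-inject₁ (fromℕ< d<k)) (toℕ-fromℕ< d<k))))

clamp-walk : ∀ {n} (G : Graph n) {k} (p : Fin (suc k) → Fin n) →
  (∀ i j → PathAdj i j → adj G (p i) (p j) ≡ true) →
  ∀ d → d < k → adj G (p (clamp k d)) (p (clamp k (suc d))) ≡ true
clamp-walk G {k} p path d d<k =
  path _ _ (inj₁ (trans (cong suc (toℕ-clamp k d (<⇒≤ d<k))) (≡-sym (toℕ-clamp k (suc d) d<k))))

clamp-injective : ∀ {n k} (p : Fin (suc k) → Fin n) → Injective _≡_ _≡_ p →
  ∀ d d' → d ≤ k → d' ≤ k → p (clamp k d) ≡ p (clamp k d') → d ≡ d'
clamp-injective {k = k} p p-inj d d' d≤k d'≤k e =
  trans (≡-sym (toℕ-clamp k d d≤k)) (trans (cong toℕ (p-inj e)) (toℕ-clamp k d' d'≤k))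

complete-internal-vertex : ∀ {n} (G H : Graph n) → Chordal H → G ⊆ H →
  (ℓ : ℕ) (p : Fin (suc (suc ℓ)) → Fin n) → Injective _≡_ _≡_ p →
  (∀ i j → PathAdj i j → adj G (p i) (p j) ≡ true) →
  adj H (p zero) (p (fromℕ (suc ℓ))) ≡ false →
  Σ (Fin ℓ) λ i → ∀ x → inX G (p zero) (p (fromℕ (suc ℓ))) x ≡ true →
    p (suc (inject₁ i)) ≢ x → adj H (p (suc (inject₁ i))) x ≡ true
complete-internal-vertex G H chordal G⊆H ℓ p p-inj path u≁v
  rewrite ≡-sym (clamp-last (suc ℓ))
  with complete-vertex G H chordal G⊆H (p ∘ clamp (suc ℓ)) ℓ
         (clamp-walk G p path) (clamp-injective p p-inj) u≁v
... | zero , () , _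
... | suc b , _ , b<ℓ , complete =
  fromℕ< b<ℓ , subst (λ w → ∀ x → inX G (p zero) (p (clamp (suc ℓ) (suc ℓ))) x ≡ true →
                                   w ≢ x → adj H w x ≡ true)
                     (cong (p ∘ suc) (clamp-inject b b<ℓ)) complete

lemma1 : ∀ {n : ℕ} (G : Graph n) (k : ℕ) (u v : Fin n) →
    adj G u v ≡ false →
    (ℓ : ℕ) (p : Fin (suc (suc ℓ)) → Fin n) →
    p zero ≡ u → p (fromℕ (suc ℓ)) ≡ v →
    Injective _≡_ _≡_ p →
    (∀ i j → (adj G (p i) (p j) ≡ true) ⇔ PathAdj i j) →
    (∀ (i : Fin ℓ) → k ≤ countXminusN G u v (p (suc (inject₁ i))) * countXminusN G u v (p (suc (inject₁ i)))) →
    YES G (+ k) ⇔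
      (YES (G ∪ single u v) (+ k - + 1) ⊎
       Σ (Fin ℓ) λ i → YES (G ∪ Fset G u v (p (suc (inject₁ i))))
                           (+ k - + edgeCount (Fset G u v (p (suc (inject₁ i))))))
lemma1 {n} G k u v u≁v ℓ p refl refl p-inj p-adj _ = mk⇔ only-if if
  where
  F[_] : Fin ℓ → Graph n
  F[ i ] = Fset G u v (p (suc (inject₁ i)))

  Branches : Set
  Branches = YES (G ∪ single u v) (+ k - + 1) ⊎
             Σ (Fin ℓ) λ i → YES (G ∪ F[ i ]) (+ k - + edgeCount F[ i ])

  u≢v : u ≢ v
  u≢v e with p-inj e
  ... | ()

  only-if : YES G (+ k) → Branches
  only-if (F , |F|≤k , chordal) with adj (G ∪ F) u v in uv∈G∪F
  ... | true = inj₁ (remove-fill G (single u v) F k 1 (single-⊆ F uv∈F)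
                       (edgeCount-pos (single u v) u v (single-edge u≢v)) |F|≤k chordal)
    where
    uv∈F : adj F u v ≡ true
    uv∈F = ∨-resolve u≁v (trans (≡-sym (∪-adj G F u v)) uv∈G∪F)
  ... | false with complete-internal-vertex G (G ∪ F) chordal (⊆-∪ G F) ℓ p p-inj
                     (λ i j → Equivalence.from (p-adj i j)) uv∈G∪F
  ...   | i , complete = inj₂ (i , remove-fill G F[ i ] F k (edgeCount F[ i ])
                                     (Fset-⊆ G F u v _ complete) ≤-refl |F|≤k chordal)

  if : Branches → YES G (+ k)
  if (inj₁ yes₀) = add-fill G (single u v) k 1 (edgeCount-single u v) yes₀
  if (inj₂ (i , yesᵢ)) = add-fill G F[ i ] k (edgeCount F[ i ]) ≤-refl yesᵢ
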